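{- Let $\mathbb{k}=GF(2)$ and let $G$ be a finite simple graph that is not 3-colorable and that contains an edge $e$ such that $G\setminus e$ (the graph with $e$ deleted) is 3-colorable, and $e$ lies on no $3$-cycle and no $4$-cycle of $G$. Then $N_{\mathbb{k}}(G)>1$.
   Context: For a graph $G$ with vertices $v_1,\dots,v_n$ and edge set $E$, Bayer's formulation of 3-colorability over a field $\mathbb{k}$ is the system in $\mathbb{k}[x_1,\dots,x_n]$ consisting of $x_i^3-1=0$ for every vertex $v_i$ and $x_i^2+x_ix_j+x_j^2=0$ for every edge $v_iv_j\in E$; for $\mathrm{char}(\mathbb{k})\neq3$ it has a solution over $\overline{\mathbb{k}}$ iff $G$ is 3-colorable. A Nullstellensatz certificate for a system $f_1=\dots=f_s=0$ is a tuple $\alpha_1,\dots,\alpha_s\in\mathbb{k}[x_1,\dots,x_n]$ with $1=\sum_i\alpha_if_i$, of degree $\max_i\deg\alpha_i$. For non-3-colorable $G$, $N_{\mathbb{k}}(G)$ is the minimum degree of a Nullstellensatz certificate for Bayer's formulation of $G$ over $\mathbb{k}$. -}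

module Defs where

open import Data.Bool using (Bool; true; false; _xor_; _∧_; if_then_else_)
open import Data.Nat using (ℕ; zero; suc; _+_; _≤_; _<ᵇ_)
import Data.Nat as ℕ
open import Data.Fin using (Fin; toℕ)
open import Data.Vec using (Vec; replicate; zipWith; _[_]≔_; toList)
open import Data.Vec.Properties using (≡-dec)
open import Data.List using (List; []; _∷_; _++_; concatMap; map; foldr; allFin)
open import Data.Nat.ListAction using (sum)
open import Data.Sum using (_⊎_)
open import Data.Product using (Σ; ∃; _×_; _,_)
open import Data.Empty using (⊥)
open import Relation.Nullary using (¬_; yes; no)
open import Relation.Binary.PropositionalEquality using (_≡_)

record Graph (n : ℕ) : Set where
  field
    adj     : Fin n → Fin n → Bool
    symm    : ∀ i j → adj i j ≡ adj j i
    irrefl  : ∀ i → adj i i ≡ false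
open Graph public

Edge : ∀ {n} → Graph n → Fin n → Fin n → Set
Edge G i j = adj G i j ≡ true

ThreeColorable : ∀ {n} → Graph n → Set
ThreeColorable {n} G = Σ (Fin n → Fin 3) λ c → ∀ i j → Edge G i j → ¬ (c i ≡ c j)

ThreeColorableMinusEdge : ∀ {n} → Graph n → Fin n → Fin n → Set
ThreeColorableMinusEdge {n} G u v =
  Σ (Fin n → Fin 3) λ c → ∀ i j → Edge G i j →
    ¬ ((i ≡ u × j ≡ v) ⊎ (i ≡ v × j ≡ u)) → ¬ (c i ≡ c j)

OnTriangle : ∀ {n} → Graph n → Fin n → Fin n → Set
OnTriangle {n} G u v = Σ (Fin n) λ w → Edge G u w × Edge G w v

OnSquare : ∀ {n} → Graph n → Fin n → Fin n → Set
OnSquare {n} G u v = Σ (Fin n) λ w → Σ (Fin n) λ x →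
  Edge G u w × Edge G w x × Edge G x v ×
  ¬ (w ≡ v) × ¬ (x ≡ u) × ¬ (w ≡ x)

-- Polynomials over GF(2) = (Bool, xor, ∧) in variables x_0 … x_{n-1}.
-- A monomial is an exponent vector; a polynomial is represented by a
-- finite list of monomials, its coefficient at a monomial being the parity
-- of the number of occurrences.

Mono : ℕ → Set
Mono n = Vec ℕ n

Poly : ℕ → Set
Poly n = List (Mono n)

coeff : ∀ {n} → Mono n → Poly n → Bool
coeff m []       = false
coeff m (a ∷ p) with ≡-dec ℕ._≟_ m a
... | yes _ = true xor coeff m p
... | no  _ = coeff m p

_≈P_ : ∀ {n} → Poly n → Poly n → Set
p ≈P q = ∀ m → coeff m p ≡ coeff m q

totalDeg : ∀ {n} → Mono n → ℕ
totalDeg m = sum (toList m)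

-- deg p ≤ d  (the zero polynomial has every degree bound)
DegLE : ∀ {n} → Poly n → ℕ → Set
DegLE p d = ∀ m → coeff m p ≡ true → totalDeg m ≤ d

0P : ∀ {n} → Poly n
0P = []

1P : ∀ {n} → Poly n
1P = replicate _ 0 ∷ []

-- in characteristic 2, subtraction coincides with addition
_+P_ : ∀ {n} → Poly n → Poly n → Poly n
p +P q = p ++ q

_-P_ : ∀ {n} → Poly n → Poly n → Poly n
p -P q = p +P q

_*P_ : ∀ {n} → Poly n → Poly n → Poly n
p *P q = concatMap (λ a → map (zipWith _+_ a) q) p

var : ∀ {n} → Fin n → Poly n
var i = (replicate _ 0 [ i ]≔ 1) ∷ []

ΣP : ∀ {n} {k : ℕ} → (Fin k → Poly n) → Poly n
ΣP {k = k} f = foldr (λ i acc → f i +P acc) 0P (allFin k)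

vertexPoly : ∀ {n} → Fin n → Poly n
vertexPoly i = (var i *P (var i *P var i)) -P 1P

edgePoly : ∀ {n} → Fin n → Fin n → Poly n
edgePoly i j = ((var i *P var i) +P (var i *P var j)) +P (var j *P var j)

certSum : ∀ {n} → Graph n → (Fin n → Poly n) → (Fin n → Fin n → Poly n) → Poly n
certSum {n} G α β =
  ΣP (λ i → α i *P vertexPoly i) +P
  ΣP (λ i → ΣP (λ j →
    if adj G i j ∧ (toℕ i <ᵇ toℕ j) then β i j *P edgePoly i j else 0P))

HasCertificate : ∀ {n} → Graph n → ℕ → Set
HasCertificate {n} G d =
  Σ (Fin n → Poly n) λ α → Σ (Fin n → Fin n → Poly n) λ β →
    (∀ i → DegLE (α i) d) ×
    (∀ i j → Edge G i j → toℕ i ℕ.< toℕ j → DegLE (β i j) d) ×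
    (1P ≈P certSum G α β)

NullstellensatzDegreeExceeds : ∀ {n} → Graph n → ℕ → Set
NullstellensatzDegreeExceeds G d = ¬ HasCertificate G d

-- A certificate of degree 1 is refuted by a GF(2)-linear functional Λ on polynomials with Λ(1) = 1
-- that vanishes on m (x_i³ − 1) and on m (x_i² + x_i x_j + x_j²) for every vertex i, edge ij and
-- monomial m of degree at most 1.  As G is not 3-colourable, every proper 3-colouring c of G ∖ e gives
-- u and v the same colour, which we normalise to 0.  Let ω generate GF(4)ˣ and let p be the point
-- x ↦ ω^c(x).  On cubic monomials, m ↦ Tr(ω m(p)) meets every constraint except those of the edge uv,
-- because p is a common zero of all the other edge polynomials.  A correction supported on monomials
-- divisible by x_u or x_v repairs the edge uv, and since e lies on no 3- or 4-cycle it spoils no other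
-- edge.  Λ(m) depends only on how the variables of m are distributed over u, v, the neighbours of u
-- and of v (with their colours) and the remaining vertices, so the constraints reduce to a finite check.
module Submission where

open import Defs
open import Algebra.Properties.CommutativeSemigroup as CommSemigroupProps using ()
open import Data.Bool using (Bool; true; false; not; _∧_; _∨_; _xor_; if_then_else_; T)
import Data.Bool as Bool
open import Data.Bool.ListAction using (all)
open import Data.Bool.Properties using (T-∧; xor-assoc; xor-same)
open import Data.Empty using (⊥-elim)
open import Data.Fin using (Fin; zero; suc; toℕ; _≟_)
open import Data.Fin.Patterns using (0F; 1F; 2F)
open import Data.Fin.Permutation using (transpose; flip; _⟨$⟩ʳ_; inverseˡ)
open import Data.List using (List; []; _∷_; _++_; map; foldr; allFin; cartesianProduct)
open import Data.List.Membership.Propositional using (_∈_)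
open import Data.List.Membership.Propositional.Properties using (∈-map⁺; ∈-allFin; ∈-cartesianProduct⁺)
open import Data.List.Relation.Unary.All using (lookup)
open import Data.List.Relation.Unary.All.Properties using (all⁺)
open import Data.List.Relation.Unary.Any using (here; there)
open import Data.Maybe using (Maybe; nothing; just)
import Data.Maybe as Maybe
import Data.Nat as ℕ
open import Data.Nat using (ℕ; zero; suc; _+_; _*_; _≤_; s≤s; _≡ᵇ_; _<ᵇ_; _%_)
open import Data.Nat.Properties using (+-identityʳ; *-identityˡ; *-distribʳ-+; +-commutativeSemigroup; m+n≡0⇒m≡0; m+n≡0⇒n≡0; n≤0⇒n≡0; <ᵇ⇒<)
open import Data.Product using (Σ; ∃; _×_; _,_)
open import Data.Sum using (_⊎_; inj₁; inj₂)
open import Data.Unit using (tt)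
open import Data.Vec using ([]; _∷_; replicate; zipWith; _[_]≔_)
open import Data.Vec.Properties using (≡-dec)
open import Function using (_∘_; Equivalence; Injection)
open import Function.Definitions using (Injective)
open import Function.Properties.Inverse using (↔⇒↣)
open import Relation.Nullary using (¬_; Dec; yes; no; does)
open import Relation.Nullary.Decidable using (⌊_⌋; toWitness; _×-dec_; _⊎-dec_)
open import Relation.Binary.PropositionalEquality

open CommSemigroupProps +-commutativeSemigroup using (interchange)

private
  true≢false : true ≢ false
  true≢false ()

  xor≡false⇒≡ : ∀ {x y} → x xor y ≡ false → x ≡ y
  xor≡false⇒≡ {false} {false} _ = refl
  xor≡false⇒≡ {true}  {true}  _ = refl

  xor-pair≡0 : ∀ {x y} → x ≡ y → x xor (y xor false) ≡ false
  xor-pair≡0 {false} refl = refl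
  xor-pair≡0 {true}  refl = refl

  xor-sum≡0 : ∀ {x y z} → x xor y ≡ z → x xor (y xor (z xor false)) ≡ false
  xor-sum≡0 {false} {false} refl = refl
  xor-sum≡0 {false} {true}  refl = refl
  xor-sum≡0 {true}  {false} refl = refl
  xor-sum≡0 {true}  {true}  refl = refl

  xor-swap : ∀ x y z → x xor (y xor z) ≡ y xor (x xor z)
  xor-swap false y     z = refl
  xor-swap true  false z = refl
  xor-swap true  true  z = refl

  xor-absorb : ∀ x c e → x xor ((c ∧ x) xor e) ≡ (not c ∧ x) xor e
  xor-absorb false false e     = refl
  xor-absorb false true  e     = refl
  xor-absorb true  false e     = refl
  xor-absorb true  true  false = refl
  xor-absorb true  true  true  = refl

  T-if : ∀ {b x} → T (if b then x else true) → T b → T x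
  T-if {true} x _ = x

coeff-∷-self : ∀ {n} (a : Mono n) p → coeff a (a ∷ p) ≡ not (coeff a p)
coeff-∷-self a p with ≡-dec ℕ._≟_ a a
... | yes _   = refl
... | no  a≢a = ⊥-elim (a≢a refl)

coeff-∷-≢ : ∀ {n} {m a : Mono n} p → m ≢ a → coeff m (a ∷ p) ≡ coeff m p
coeff-∷-≢ {m = m} {a} p m≢a with ≡-dec ℕ._≟_ m a
... | yes m≡a = ⊥-elim (m≢a m≡a)
... | no  _   = refl

coeff-++ : ∀ {n} (m : Mono n) p q → coeff m (p ++ q) ≡ coeff m p xor coeff m q
coeff-++ m []      q = refl
coeff-++ m (a ∷ p) q with ≡-dec ℕ._≟_ m a
... | yes _ = trans (cong (true xor_) (coeff-++ m p q)) (sym (xor-assoc true (coeff m p) (coeff m q)))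
... | no  _ = coeff-++ m p q

⟦_⟧ : ∀ {n} → (Mono n → Bool) → Poly n → Bool
⟦ φ ⟧ []      = false
⟦ φ ⟧ (a ∷ p) = φ a xor ⟦ φ ⟧ p

module _ {n} (φ : Mono n → Bool) where

  ⟦⟧-++ : ∀ p q → ⟦ φ ⟧ (p ++ q) ≡ ⟦ φ ⟧ p xor ⟦ φ ⟧ q
  ⟦⟧-++ []      q = refl
  ⟦⟧-++ (a ∷ p) q = trans (cong (φ a xor_) (⟦⟧-++ p q)) (sym (xor-assoc (φ a) _ _))

  ⟦⟧-*P : ∀ p q → ⟦ φ ⟧ (p *P q) ≡ ⟦ (λ a → ⟦ φ ⟧ (map (zipWith _+_ a) q)) ⟧ p
  ⟦⟧-*P []      q = refl
  ⟦⟧-*P (a ∷ p) q = trans (⟦⟧-++ (map (zipWith _+_ a) q) (p *P q)) (cong (⟦ φ ⟧ (map (zipWith _+_ a) q) xor_) (⟦⟧-*P p q))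

  ⟦⟧-ΣP : ∀ {k} (f : Fin k → Poly n) → (∀ i → ⟦ φ ⟧ (f i) ≡ false) → ⟦ φ ⟧ (ΣP f) ≡ false
  ⟦⟧-ΣP {k} f f≡0 = go (allFin k)
    where
    go : ∀ is → ⟦ φ ⟧ (foldr (λ i acc → f i +P acc) 0P is) ≡ false
    go []       = refl
    go (i ∷ is) = trans (⟦⟧-++ (f i) _) (cong₂ _xor_ (f≡0 i) (go is))

_∖_ : ∀ {n} → (Mono n → Bool) → Mono n → Mono n → Bool
(φ ∖ a) m = if does (≡-dec ℕ._≟_ a m) then false else φ m

⟦⟧-erase : ∀ {n} (φ : Mono n → Bool) a p → ⟦ φ ⟧ p ≡ (coeff a p ∧ φ a) xor ⟦ φ ∖ a ⟧ p
⟦⟧-erase φ a []      = refl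
⟦⟧-erase φ a (b ∷ p) with ≡-dec ℕ._≟_ a b
... | yes refl = trans (cong (φ a xor_) (⟦⟧-erase φ a p)) (xor-absorb (φ a) (coeff a p) _)
... | no  _    = trans (cong (φ b xor_) (⟦⟧-erase φ a p)) (xor-swap (φ b) (coeff a p ∧ φ a) _)

⟦⟧-vanishes : ∀ {n} (φ : Mono n → Bool) p → (∀ m → coeff m p ≡ true → φ m ≡ false) → ⟦ φ ⟧ p ≡ false
⟦⟧-vanishes φ []      _   = refl
⟦⟧-vanishes φ (a ∷ p) φ≡0 = begin
  φ a xor ⟦ φ ⟧ p                              ≡⟨ cong (φ a xor_) (⟦⟧-erase φ a p) ⟩
  φ a xor ((coeff a p ∧ φ a) xor ⟦ φ ∖ a ⟧ p)  ≡⟨ xor-absorb (φ a) (coeff a p) _ ⟩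
  (not (coeff a p) ∧ φ a) xor ⟦ φ ∖ a ⟧ p      ≡⟨ cong₂ _xor_ φa≡0-or-cancelled (⟦⟧-vanishes (φ ∖ a) p φ∖a≡0) ⟩
  false                                        ∎
  where
  open ≡-Reasoning
  φa≡0-or-cancelled : not (coeff a p) ∧ φ a ≡ false
  φa≡0-or-cancelled with not (coeff a p) in odd
  ... | false = refl
  ... | true  = φ≡0 a (trans (coeff-∷-self a p) odd)
  φ∖a≡0 : ∀ m → coeff m p ≡ true → (φ ∖ a) m ≡ false
  φ∖a≡0 m m∈p with ≡-dec ℕ._≟_ a m
  ... | yes _   = refl
  ... | no  a≢m = φ≡0 m (trans (coeff-∷-≢ p (a≢m ∘ sym)) m∈p)

⟦⟧-*P-vanishes : ∀ {n} (φ : Mono n → Bool) p q →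
  (∀ a → coeff a p ≡ true → ⟦ φ ⟧ (map (zipWith _+_ a) q) ≡ false) → ⟦ φ ⟧ (p *P q) ≡ false
⟦⟧-*P-vanishes φ p q vanishes = trans (⟦⟧-*P φ p q) (⟦⟧-vanishes _ p vanishes)

⟦⟧-cong : ∀ {n} (φ : Mono n → Bool) {p q} → p ≈P q → ⟦ φ ⟧ p ≡ ⟦ φ ⟧ q
⟦⟧-cong φ {p} {q} p≈q = xor≡false⇒≡ (begin
  ⟦ φ ⟧ p xor ⟦ φ ⟧ q  ≡⟨ ⟦⟧-++ φ p q ⟨
  ⟦ φ ⟧ (p ++ q)       ≡⟨ ⟦⟧-vanishes φ (p ++ q) (λ m m∈p++q → ⊥-elim (true≢false (trans (sym m∈p++q) (p++q≈0 m)))) ⟩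
  false                ∎)
  where
  open ≡-Reasoning
  p++q≈0 : ∀ m → coeff m (p ++ q) ≡ false
  p++q≈0 m = begin
    coeff m (p ++ q)         ≡⟨ coeff-++ m p q ⟩
    coeff m p xor coeff m q  ≡⟨ cong (_xor coeff m q) (p≈q m) ⟩
    coeff m q xor coeff m q  ≡⟨ xor-same (coeff m q) ⟩
    false                    ∎

unit : ∀ {n} → Fin n → Mono n
unit i = replicate _ 0 [ i ]≔ 1

weight : ∀ {n} → (Fin n → ℕ) → Mono n → ℕ
weight g []      = 0
weight g (e ∷ m) = e * g zero + weight (g ∘ suc) m

weight-+ : ∀ {n} (g : Fin n → ℕ) a b → weight g (zipWith _+_ a b) ≡ weight g a + weight g b
weight-+ g []      []      = refl
weight-+ g (x ∷ a) (y ∷ b) = begin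
  (x + y) * g zero + weight (g ∘ suc) (zipWith _+_ a b)
    ≡⟨ cong₂ _+_ (*-distribʳ-+ (g zero) x y) (weight-+ (g ∘ suc) a b) ⟩
  (x * g zero + y * g zero) + (weight (g ∘ suc) a + weight (g ∘ suc) b)
    ≡⟨ interchange (x * g zero) (y * g zero) (weight (g ∘ suc) a) (weight (g ∘ suc) b) ⟩
  (x * g zero + weight (g ∘ suc) a) + (y * g zero + weight (g ∘ suc) b) ∎
  where open ≡-Reasoning

weight-0 : ∀ {n} (g : Fin n → ℕ) → weight g (replicate n 0) ≡ 0
weight-0 {zero}  g = refl
weight-0 {suc n} g = weight-0 (g ∘ suc)

weight-unit : ∀ {n} (g : Fin n → ℕ) i → weight g (unit i) ≡ g i
weight-unit {suc n} g zero    = trans (cong₂ _+_ (*-identityˡ (g zero)) (weight-0 (g ∘ suc))) (+-identityʳ (g zero))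
weight-unit {suc n} g (suc i) = weight-unit (g ∘ suc) i

lowMono : ∀ {n} → Maybe (Fin n) → Mono n
lowMono nothing  = replicate _ 0
lowMono (just i) = unit i

totalDeg≡0⇒zero : ∀ {n} (a : Mono n) → totalDeg a ≡ 0 → a ≡ replicate n 0
totalDeg≡0⇒zero []      _   = refl
totalDeg≡0⇒zero (x ∷ a) a≡0 = cong₂ _∷_ (m+n≡0⇒m≡0 x a≡0) (totalDeg≡0⇒zero a (m+n≡0⇒n≡0 x a≡0))

totalDeg≤1⇒lowMono : ∀ {n} (a : Mono n) → totalDeg a ≤ 1 → ∃ λ i → a ≡ lowMono i
totalDeg≤1⇒lowMono []                  _          = nothing , refl
totalDeg≤1⇒lowMono (zero ∷ a)          a≤1        with totalDeg≤1⇒lowMono a a≤1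
... | nothing , refl = nothing , refl
... | just i  , refl = just (suc i) , refl
totalDeg≤1⇒lowMono (suc zero ∷ a)      (s≤s a≤0)  = just zero , cong (1 ∷_) (totalDeg≡0⇒zero a (n≤0⇒n≡0 a≤0))
totalDeg≤1⇒lowMono (suc (suc x) ∷ a)   (s≤s ())

data Role : Set where
  at-u at-v near-u near-v far : Role

Kind : Set
Kind = Role × Fin 3

data Feature : Set where
  deg deg-u deg-v deg-near-u deg-near-v deg-near-u₂ deg-near-v₁ colour-sum : Feature

Census : Set
Census = Feature → ℕ

∅ : Census
∅ _ = 0

_⊕_ : Census → Census → Census
(s ⊕ t) f = s f + t f

contribution : Kind → Census
contribution _            deg         = 1
contribution (at-u , _)   deg-u       = 1
contribution (at-v , _)   deg-v       = 1
contribution (near-u , _) deg-near-u  = 1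
contribution (near-v , _) deg-near-v  = 1
contribution (near-u , 2F) deg-near-u₂ = 1
contribution (near-v , 1F) deg-near-v₁ = 1
contribution (_ , c)      colour-sum  = toℕ c
contribution _            _           = 0

lowCensus : Maybe Kind → Census
lowCensus nothing  = ∅
lowCensus (just t) = contribution t

-- Tr_{GF(4)/GF(2)} (ω^(w+1)): the value Tr(ω m(p)) for a monomial m of colour sum w.
trace : ℕ → Bool
trace w = w % 3 <ᵇ 2

isOne : ℕ → Bool
isOne k = k ≡ᵇ 1

correction : (du dv nu nv nu₂ nv₁ : ℕ) → Bool
correction 2 1 _  _  _   _   = true
correction 0 2 _  _  nu₂ _   = isOne nu₂
correction 2 0 _  _  _   nv₁ = isOne nv₁
correction 0 1 _  nv nu₂ _   = isOne nv ∧ isOne nu₂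
correction 1 0 nu _  _   nv₁ = isOne nu ∧ isOne nv₁
correction _ _ _  _  _   _   = false

dual′ : (d du dv nu nv nu₂ nv₁ w : ℕ) → Bool
dual′ 0 _  _  _  _  _   _   _ = true
dual′ 3 1  1  _  _  nu₂ nv₁ _ = isOne nu₂ xor isOne nv₁
dual′ 3 du dv nu nv nu₂ nv₁ w = trace w xor correction du dv nu nv nu₂ nv₁
dual′ _ _  _  _  _  _   _   _ = false

dual : Census → Bool
dual s = dual′ (s deg) (s deg-u) (s deg-v) (s deg-near-u) (s deg-near-v) (s deg-near-u₂) (s deg-near-v₁) (s colour-sum)

dual-cong : ∀ {s t} → (∀ f → s f ≡ t f) → dual s ≡ dual t
dual-cong e rewrite e deg | e deg-u | e deg-v | e deg-near-u | e deg-near-v | e deg-near-u₂ | e deg-near-v₁ | e colour-sum = refl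

admissible : Kind → Bool
admissible (at-u , 0F)   = true
admissible (at-v , 0F)   = true
admissible (near-u , 0F) = false
admissible (near-v , 0F) = false
admissible (near-u , _)  = true
admissible (near-v , _)  = true
admissible (far , _)     = true
admissible _             = false

admissibleLow : Maybe Kind → Bool
admissibleLow nothing  = true
admissibleLow (just t) = admissible t

roleAdjacent : Role → Role → Bool
roleAdjacent at-u   at-v   = true
roleAdjacent at-v   at-u   = true
roleAdjacent at-u   near-u = true
roleAdjacent near-u at-u   = true
roleAdjacent at-v   near-v = true
roleAdjacent near-v at-v   = true
roleAdjacent near-u near-u = true
roleAdjacent near-v near-v = true
roleAdjacent near-u far    = true
roleAdjacent far    near-u = true
roleAdjacent near-v far    = true
roleAdjacent far    near-v = true
roleAdjacent far    far    = true
roleAdjacent _      _      = false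

isUV : Role → Role → Bool
isUV at-u at-v = true
isUV at-v at-u = true
isUV _    _    = false

adjacent : Kind → Kind → Bool
adjacent (r , c) (s , d) = roleAdjacent r s ∧ (isUV r s ∨ not ⌊ c ≟ d ⌋)

roles : List Role
roles = at-u ∷ at-v ∷ near-u ∷ near-v ∷ far ∷ []

∈-roles : ∀ r → r ∈ roles
∈-roles at-u   = here refl
∈-roles at-v   = there (here refl)
∈-roles near-u = there (there (here refl))
∈-roles near-v = there (there (there (here refl)))
∈-roles far    = there (there (there (there (here refl))))

kinds : List Kind
kinds = cartesianProduct roles (allFin 3)

∈-kinds : ∀ t → t ∈ kinds
∈-kinds (r , c) = ∈-cartesianProduct⁺ (∈-roles r) (∈-allFin c)

lowKinds : List (Maybe Kind)
lowKinds = nothing ∷ map just kinds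

∈-lowKinds : ∀ a → a ∈ lowKinds
∈-lowKinds nothing  = here refl
∈-lowKinds (just t) = there (∈-map⁺ just (∈-kinds t))

all-sound : ∀ {A : Set} (p : A → Bool) {xs : List A} → (∀ x → x ∈ xs) → T (all p xs) → ∀ x → T (p x)
all-sound p {xs} complete holds x = lookup (all⁺ p xs holds) (complete x)

vertexBalanced : Kind × Maybe Kind → Bool
vertexBalanced (t , a) =
  if admissible t ∧ admissibleLow a
  then ⌊ dual (lowCensus a ⊕ (contribution t ⊕ (contribution t ⊕ contribution t))) Bool.≟ dual (lowCensus a ⊕ ∅) ⌋
  else true

edgeBalanced : Kind × Kind × Maybe Kind → Bool
edgeBalanced (s , t , a) =
  if adjacent s t ∧ (admissible s ∧ (admissible t ∧ admissibleLow a))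
  then ⌊ dual (A ⊕ (S ⊕ S)) xor dual (A ⊕ (S ⊕ T′)) Bool.≟ dual (A ⊕ (T′ ⊕ T′)) ⌋
  else true
  where
  A = lowCensus a
  S = contribution s
  T′ = contribution t

vertex-balanced : ∀ t a → T (admissible t) → T (admissibleLow a) →
  dual (lowCensus a ⊕ (contribution t ⊕ (contribution t ⊕ contribution t))) ≡ dual (lowCensus a ⊕ ∅)
vertex-balanced t a t-ok a-ok = toWitness (T-if (all-sound vertexBalanced complete table (t , a)) (Equivalence.from T-∧ (t-ok , a-ok)))
  where
  complete : ∀ x → x ∈ cartesianProduct kinds lowKinds
  complete (t , a) = ∈-cartesianProduct⁺ (∈-kinds t) (∈-lowKinds a)
  -- decided by evaluation: the type reduces to ⊤
  table : T (all vertexBalanced (cartesianProduct kinds lowKinds))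
  table = _

edge-balanced : ∀ s t a → T (adjacent s t) → T (admissible s) → T (admissible t) → T (admissibleLow a) →
  let A = lowCensus a; S = contribution s; T′ = contribution t in
  dual (A ⊕ (S ⊕ S)) xor dual (A ⊕ (S ⊕ T′)) ≡ dual (A ⊕ (T′ ⊕ T′))
edge-balanced s t a st-ok s-ok t-ok a-ok =
  toWitness (T-if (all-sound edgeBalanced complete table (s , t , a))
                  (Equivalence.from T-∧ (st-ok , Equivalence.from T-∧ (s-ok , Equivalence.from T-∧ (t-ok , a-ok)))))
  where
  complete : ∀ x → x ∈ cartesianProduct kinds (cartesianProduct kinds lowKinds)
  complete (s , t , a) = ∈-cartesianProduct⁺ (∈-kinds s) (∈-cartesianProduct⁺ (∈-kinds t) (∈-lowKinds a))
  table : T (all edgeBalanced (cartesianProduct kinds (cartesianProduct kinds lowKinds)))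
  table = _

Joins : ∀ {n} → Fin n → Fin n → Fin n → Fin n → Set
Joins u v i j = (i ≡ u × j ≡ v) ⊎ (i ≡ v × j ≡ u)

ProperOffEdge : ∀ {n} → Graph n → Fin n → Fin n → (Fin n → Fin 3) → Set
ProperOffEdge G u v c = ∀ i j → Edge G i j → ¬ Joins u v i j → c i ≢ c j

module _ {n} (G : Graph n) where

  edge-sym : ∀ {i j} → Edge G i j → Edge G j i
  edge-sym {i} {j} e = trans (symm G j i) e

  edge⇒≢ : ∀ {i j} → Edge G i j → i ≢ j
  edge⇒≢ {i} e refl with () ← trans (sym e) (irrefl G i)

  non-edge : ∀ {i j} → adj G i j ≡ false → ¬ Edge G i j
  non-edge i≁j e with () ← trans (sym e) i≁j

module NoLowDegreeCertificate {n} (G : Graph n) (u v : Fin n) (c : Fin n → Fin 3)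
  (c-u : c u ≡ 0F) (c-v : c v ≡ 0F) (proper : ProperOffEdge G u v c)
  (no-triangle : ¬ OnTriangle G u v) (no-square : ¬ OnSquare G u v) where

  data View (x : Fin n) : Set where
    is-u      : x ≡ u → View x
    is-v      : x ≡ v → x ≢ u → View x
    is-near-u : Edge G u x → x ≢ u → x ≢ v → View x
    is-near-v : Edge G v x → adj G u x ≡ false → x ≢ u → x ≢ v → View x
    is-far    : adj G u x ≡ false → adj G v x ≡ false → x ≢ u → x ≢ v → View x

  view : ∀ x → View x
  view x with x ≟ u | x ≟ v | adj G u x in u~x | adj G v x in v~x
  ... | yes x≡u | _       | _     | _     = is-u x≡u
  ... | no  x≢u | yes x≡v | _     | _     = is-v x≡v x≢u
  ... | no  x≢u | no  x≢v | true  | _     = is-near-u u~x x≢u x≢v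
  ... | no  x≢u | no  x≢v | false | true  = is-near-v v~x u~x x≢u x≢v
  ... | no  x≢u | no  x≢v | false | false = is-far u~x v~x x≢u x≢v

  roleOf : ∀ {x} → View x → Role
  roleOf (is-u _)            = at-u
  roleOf (is-v _ _)          = at-v
  roleOf (is-near-u _ _ _)   = near-u
  roleOf (is-near-v _ _ _ _) = near-v
  roleOf (is-far _ _ _ _)    = far

  kind : Fin n → Kind
  kind x = roleOf (view x) , c x

  not-joinsˡ : ∀ {i j} → i ≢ u → i ≢ v → ¬ Joins u v i j
  not-joinsˡ i≢u _   (inj₁ (i≡u , _)) = i≢u i≡u
  not-joinsˡ _   i≢v (inj₂ (i≡v , _)) = i≢v i≡v

  not-joinsʳ : ∀ {i j} → j ≢ u → j ≢ v → ¬ Joins u v i j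
  not-joinsʳ _   j≢v (inj₁ (_ , j≡v)) = j≢v j≡v
  not-joinsʳ j≢u _   (inj₂ (_ , j≡u)) = j≢u j≡u

  admissible-view : ∀ {x} (w : View x) → T (admissible (roleOf w , c x))
  admissible-view (is-u refl)   rewrite c-u = tt
  admissible-view (is-v refl _) rewrite c-v = tt
  admissible-view {x} (is-near-u u~x x≢u x≢v) with c x in cx
  ... | 0F = proper u x u~x (not-joinsʳ x≢u x≢v) (trans c-u (sym cx))
  ... | 1F = tt
  ... | 2F = tt
  admissible-view {x} (is-near-v v~x _ x≢u x≢v) with c x in cx
  ... | 0F = proper v x v~x (not-joinsʳ x≢u x≢v) (trans c-v (sym cx))
  ... | 1F = tt
  ... | 2F = tt
  admissible-view (is-far _ _ _ _) = tt

  kind-admissible : ∀ x → T (admissible (kind x))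
  kind-admissible x = admissible-view (view x)

  colours-differ : ∀ {i j} → Edge G i j → ¬ Joins u v i j → T (not ⌊ c i ≟ c j ⌋)
  colours-differ {i} {j} e not-uv with c i ≟ c j
  ... | yes same = proper i j e not-uv same
  ... | no  _    = tt

  adjacent-view : ∀ {i j} → Edge G i j → (wi : View i) (wj : View j) →
    T (adjacent (roleOf wi , c i) (roleOf wj , c j))
  adjacent-view e (is-u refl)              (is-u refl)              = edge⇒≢ G e refl
  adjacent-view e (is-u refl)              (is-v _ _)               = tt
  adjacent-view e (is-u refl)              (is-near-u _ j≢u j≢v)    = colours-differ e (not-joinsʳ j≢u j≢v)
  adjacent-view e (is-u refl)              (is-near-v _ u≁j _ _)    = non-edge G u≁j e
  adjacent-view e (is-u refl)              (is-far u≁j _ _ _)       = non-edge G u≁j e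
  adjacent-view e (is-v refl _)            (is-u _)                 = tt
  adjacent-view e (is-v refl _)            (is-v refl _)            = edge⇒≢ G e refl
  adjacent-view e (is-v refl _)            (is-near-u u~j _ _)      = no-triangle (_ , u~j , edge-sym G e)
  adjacent-view e (is-v refl _)            (is-near-v _ _ j≢u j≢v)  = colours-differ e (not-joinsʳ j≢u j≢v)
  adjacent-view e (is-v refl _)            (is-far _ v≁j _ _)       = non-edge G v≁j e
  adjacent-view e (is-near-u _ i≢u i≢v)    (is-u _)                 = colours-differ e (not-joinsˡ i≢u i≢v)
  adjacent-view e (is-near-u u~i _ _)      (is-v refl _)            = no-triangle (_ , u~i , e)
  adjacent-view e (is-near-u _ i≢u i≢v)    (is-near-u _ _ _)        = colours-differ e (not-joinsˡ i≢u i≢v)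
  adjacent-view e (is-near-u u~i _ i≢v)    (is-near-v v~j _ j≢u _)  =
    no-square (_ , _ , u~i , e , edge-sym G v~j , i≢v , j≢u , edge⇒≢ G e)
  adjacent-view e (is-near-u _ i≢u i≢v)    (is-far _ _ _ _)         = colours-differ e (not-joinsˡ i≢u i≢v)
  adjacent-view e (is-near-v _ u≁i _ _)    (is-u refl)              = non-edge G u≁i (edge-sym G e)
  adjacent-view e (is-near-v _ _ i≢u i≢v)  (is-v _ _)               = colours-differ e (not-joinsˡ i≢u i≢v)
  adjacent-view e (is-near-v v~i _ i≢u _)  (is-near-u u~j _ j≢v)    =
    no-square (_ , _ , u~j , edge-sym G e , edge-sym G v~i , j≢v , i≢u , edge⇒≢ G (edge-sym G e))
  adjacent-view e (is-near-v _ _ i≢u i≢v)  (is-near-v _ _ _ _)      = colours-differ e (not-joinsˡ i≢u i≢v)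
  adjacent-view e (is-near-v _ _ i≢u i≢v)  (is-far _ _ _ _)         = colours-differ e (not-joinsˡ i≢u i≢v)
  adjacent-view e (is-far u≁i _ _ _)       (is-u refl)              = non-edge G u≁i (edge-sym G e)
  adjacent-view e (is-far _ v≁i _ _)       (is-v refl _)            = non-edge G v≁i (edge-sym G e)
  adjacent-view e (is-far _ _ i≢u i≢v)     (is-near-u _ _ _)        = colours-differ e (not-joinsˡ i≢u i≢v)
  adjacent-view e (is-far _ _ i≢u i≢v)     (is-near-v _ _ _ _)      = colours-differ e (not-joinsˡ i≢u i≢v)
  adjacent-view e (is-far _ _ i≢u i≢v)     (is-far _ _ _ _)         = colours-differ e (not-joinsˡ i≢u i≢v)

  kind-adjacent : ∀ {i j} → Edge G i j → T (adjacent (kind i) (kind j))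
  kind-adjacent {i} {j} e = adjacent-view e (view i) (view j)

  census : Mono n → Census
  census m f = weight (λ x → contribution (kind x) f) m

  record HasCensus (m : Mono n) (s : Census) : Set where
    constructor has-census
    field census≐ : ∀ f → census m f ≡ s f
  open HasCensus

  census-+ : ∀ {a b s t} → HasCensus a s → HasCensus b t → HasCensus (zipWith _+_ a b) (s ⊕ t)
  census-+ {a} {b} a≐s b≐t = has-census λ f → trans (weight-+ _ a b) (cong₂ _+_ (census≐ a≐s f) (census≐ b≐t f))

  census-0 : HasCensus (replicate n 0) ∅
  census-0 = has-census λ f → weight-0 {n} (λ x → contribution (kind x) f)

  census-unit : ∀ i → HasCensus (unit i) (contribution (kind i))
  census-unit i = has-census λ _ → weight-unit _ i

  census-low : ∀ k → HasCensus (lowMono k) (lowCensus (Maybe.map kind k))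
  census-low nothing  = census-0
  census-low (just i) = census-unit i

  low-admissible : ∀ k → T (admissibleLow (Maybe.map kind k))
  low-admissible nothing  = tt
  low-admissible (just i) = kind-admissible i

  Λ : Mono n → Bool
  Λ m = dual (census m)

  Λ-census : ∀ {m s} → HasCensus m s → Λ m ≡ dual s
  Λ-census = dual-cong ∘ census≐

  Λ-one : ⟦ Λ ⟧ 1P ≡ true
  Λ-one = cong (_xor false) (Λ-census census-0)

  Λ-vertex : ∀ i a → totalDeg a ≤ 1 → ⟦ Λ ⟧ (map (zipWith _+_ a) (vertexPoly i)) ≡ false
  Λ-vertex i a a≤1 with totalDeg≤1⇒lowMono a a≤1
  ... | k , refl = xor-pair≡0 (begin
    Λ (zipWith _+_ (lowMono k) (zipWith _+_ x (zipWith _+_ x x)))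
      ≡⟨ Λ-census (census-+ A≐ (census-+ X≐ (census-+ X≐ X≐))) ⟩
    dual (A ⊕ (X ⊕ (X ⊕ X)))
      ≡⟨ vertex-balanced (kind i) (Maybe.map kind k) (kind-admissible i) (low-admissible k) ⟩
    dual (A ⊕ ∅)
      ≡⟨ Λ-census (census-+ A≐ census-0) ⟨
    Λ (zipWith _+_ (lowMono k) (replicate n 0)) ∎)
    where
    open ≡-Reasoning
    x = unit i
    A = lowCensus (Maybe.map kind k)
    X = contribution (kind i)
    A≐ = census-low k
    X≐ = census-unit i

  Λ-edge : ∀ {i j} → Edge G i j → ∀ a → totalDeg a ≤ 1 → ⟦ Λ ⟧ (map (zipWith _+_ a) (edgePoly i j)) ≡ false
  Λ-edge {i} {j} e a a≤1 with totalDeg≤1⇒lowMono a a≤1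
  ... | k , refl = xor-sum≡0 {Λ (a·xx)} {Λ (a·xy)} (begin
    Λ (a·xx) xor Λ (a·xy)
      ≡⟨ cong₂ _xor_ (Λ-census (census-+ A≐ (census-+ X≐ X≐))) (Λ-census (census-+ A≐ (census-+ X≐ Y≐))) ⟩
    dual (A ⊕ (X ⊕ X)) xor dual (A ⊕ (X ⊕ Y))
      ≡⟨ edge-balanced (kind i) (kind j) (Maybe.map kind k)
           (kind-adjacent e) (kind-admissible i) (kind-admissible j) (low-admissible k) ⟩
    dual (A ⊕ (Y ⊕ Y))
      ≡⟨ Λ-census (census-+ A≐ (census-+ Y≐ Y≐)) ⟨
    Λ (a·yy) ∎)
    where
    open ≡-Reasoning
    a·xx = zipWith _+_ (lowMono k) (zipWith _+_ (unit i) (unit i))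
    a·xy = zipWith _+_ (lowMono k) (zipWith _+_ (unit i) (unit j))
    a·yy = zipWith _+_ (lowMono k) (zipWith _+_ (unit j) (unit j))
    A = lowCensus (Maybe.map kind k)
    X = contribution (kind i)
    Y = contribution (kind j)
    A≐ = census-low k
    X≐ = census-unit i
    Y≐ = census-unit j

  no-certificate : ¬ HasCertificate G 1
  no-certificate (α , β , α≤1 , β≤1 , 1≈cert) = true≢false (begin
    true                    ≡⟨ Λ-one ⟨
    ⟦ Λ ⟧ 1P                ≡⟨ ⟦⟧-cong Λ {q = certSum G α β} 1≈cert ⟩
    ⟦ Λ ⟧ (certSum G α β)   ≡⟨ ⟦⟧-++ Λ (ΣP vertexTerm) (ΣP λ i → ΣP (edgeTerm i)) ⟩
    ⟦ Λ ⟧ (ΣP vertexTerm) xor ⟦ Λ ⟧ (ΣP λ i → ΣP (edgeTerm i))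
      ≡⟨ cong₂ _xor_ (⟦⟧-ΣP Λ vertexTerm vertexTerm≡0) (⟦⟧-ΣP Λ _ λ i → ⟦⟧-ΣP Λ (edgeTerm i) (edgeTerm≡0 i)) ⟩
    false ∎)
    where
    open ≡-Reasoning
    vertexTerm : Fin n → Poly n
    vertexTerm i = α i *P vertexPoly i
    edgeTerm : Fin n → Fin n → Poly n
    edgeTerm i j = if adj G i j ∧ (toℕ i <ᵇ toℕ j) then β i j *P edgePoly i j else 0P
    vertexTerm≡0 : ∀ i → ⟦ Λ ⟧ (vertexTerm i) ≡ false
    vertexTerm≡0 i = ⟦⟧-*P-vanishes Λ (α i) (vertexPoly i) λ a a∈α → Λ-vertex i a (α≤1 i a a∈α)
    edgeTerm≡0 : ∀ i j → ⟦ Λ ⟧ (edgeTerm i j) ≡ false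
    edgeTerm≡0 i j with adj G i j in i~j | toℕ i <ᵇ toℕ j in i<j
    ... | false | _     = refl
    ... | true  | false = refl
    ... | true  | true  = ⟦⟧-*P-vanishes Λ (β i j) (edgePoly i j) λ a a∈β →
      Λ-edge i~j a (β≤1 i j i~j (<ᵇ⇒< (toℕ i) (toℕ j) (subst T (sym i<j) tt)) a a∈β)

module _ {n} (G : Graph n) (u v : Fin n) where

  joins? : ∀ i j → Dec (Joins u v i j)
  joins? i j = (i ≟ u ×-dec j ≟ v) ⊎-dec (i ≟ v ×-dec j ≟ u)

  endpoints-same-colour : ¬ ThreeColorable G → ∀ {c} → ProperOffEdge G u v c → c u ≡ c v
  endpoints-same-colour not-3-colourable {c} proper with c u ≟ c v
  ... | yes same   = same
  ... | no  differ = ⊥-elim (not-3-colourable (c , proper′))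
    where
    proper′ : ∀ i j → Edge G i j → c i ≢ c j
    proper′ i j e with joins? i j
    ... | yes (inj₁ (refl , refl)) = differ
    ... | yes (inj₂ (refl , refl)) = differ ∘ sym
    ... | no  not-uv               = proper i j e not-uv

  recolour : ∀ {c} (π : Fin 3 → Fin 3) → Injective _≡_ _≡_ π →
    ProperOffEdge G u v c → ProperOffEdge G u v (π ∘ c)
  recolour π π-injective proper i j e not-uv = proper i j e not-uv ∘ π-injective

  normalise : ∀ {c} → ProperOffEdge G u v c → c u ≡ c v →
    Σ (Fin n → Fin 3) λ c′ → c′ u ≡ 0F × c′ v ≡ 0F × ProperOffEdge G u v c′
  normalise {c} proper same =
    π ∘ c , πcu≡0 , trans (cong π (sym same)) πcu≡0 , recolour π (Injection.injective (↔⇒↣ σ)) proper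
    where
    σ = flip (transpose 0F (c u))
    π = σ ⟨$⟩ʳ_
    πcu≡0 : π (c u) ≡ 0F
    πcu≡0 = inverseˡ (transpose 0F (c u))

corollary1p9 : (n : ℕ) (G : Graph n) (u v : Fin n) →
    ¬ ThreeColorable G → Edge G u v → ThreeColorableMinusEdge G u v →
    ¬ OnTriangle G u v → ¬ OnSquare G u v →
    NullstellensatzDegreeExceeds G 1
corollary1p9 n G u v not-3-colourable _ (c , proper) no-triangle no-square
  with c′ , c′u≡0 , c′v≡0 , proper′ ← normalise G u v proper (endpoints-same-colour G u v not-3-colourable proper) =
  NoLowDegreeCertificate.no-certificate G u v c′ c′u≡0 c′v≡0 proper′ no-triangle no-square
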